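{- Let $\mathcal{L}\in\{\mathrm{ML},\mathrm{ML}(\underline{\vee}),\mathrm{MDL},\mathrm{EMDL}\}$ and let $\varphi$ be an $\mathcal{L}$-formula. Every tableau for $\varphi$ in $\mathbf{T}_{\mathcal{L}}$ is finite.
   Context: Syntax (negation normal form): $\mathrm{ML}$: $\varphi::=p\mid\neg p\mid(\varphi\wedge\varphi)\mid(\varphi\vee\varphi)\mid\Diamond\varphi\mid\Box\varphi$; $\mathrm{ML}(\underline{\vee})$ adds intuitionistic disjunction $(\varphi\,\underline{\vee}\,\varphi)$; $\mathrm{MDL}$ adds atoms ${=}(p_1,\dots,p_n,q)$ (proposition symbols); $\mathrm{EMDL}$ adds atoms ${=}(\varphi_1,\dots,\varphi_n,\psi)$ with $\varphi_i,\psi\in\mathrm{ML}$. For $\chi\in\mathrm{ML}$, $\chi^\bot$ is the negation normal form of $\neg\chi$ (swap $p/\neg p$, $\wedge/\vee$, $\Diamond/\Box$) and $\chi^\top:=\chi$. $\mathrm{vrank}(\varphi)$ is the number of $\underline{\vee}$ in $\varphi$, where each dependence atom ${=}(\varphi_1,\dots,\varphi_n,\psi)$ is first replaced by $\bigvee_{\vec a\in\{\bot,\top\}^n}\bigwedge\{\varphi_1^{a_1},\dots,\varphi_n^{a_n},(\psi\,\underline{\vee}\,\psi^\bot)\}$. Labeled tableaux: labels are finite subsets of $\mathbb{N}$; nodes carry labeled formulas $\alpha:\varphi$ or accessibility formulas $i\mathsf{R}j$ ($i,j\in\mathbb{N}$). A tableau is a finitely branching tree built from the root by rule applications; a rule extends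 a branch containing its premises by alternatives (separated by $\mid$), each adding all its listed items; a labeled formula is never added to a branch already containing it, and rule ($\Box$) is never applied twice to the same labeled formula on a branch. Rules: (Prop) from $\{i_1,\dots,i_k\}:p$: $\{i_1\}:p\mid\dots\mid\{i_k\}:p$; ($\neg$Prop) likewise for $\neg p$; ($\wedge$) from $\alpha:(\varphi\wedge\psi)$: $\alpha:\varphi\mid\alpha:\psi$; ($\vee$) from $\alpha:(\varphi\vee\psi)$ and any $\beta\subseteq\alpha$: $\beta:\varphi\mid\alpha\setminus\beta:\psi$; ($\underline{\vee}$) from $\alpha:(\varphi\,\underline{\vee}\,\psi)$: add $\alpha:\varphi$ and $\alpha:\psi$; (Split) from $\alpha:{=}(\vec\chi,\theta)$: $\alpha_1:{=}(\vec\chi,\theta)\mid\dots\mid\alpha_k:{=}(\vec\chi,\theta)$ with $\alpha_1,\dots,\alpha_k$ all 2-element subsets of $\alpha$; (PL dep) from $\{i_1,i_2\}:{=}(p_1,\dots,p_n,q)$: one alternative per $g:\{1,\dots,n\}\to\{\top,\bot\}$ adding $\{i_1\}:p_m^{g(m)},\{i_2\}:p_m^{g(m)}$ ($m\le n$), $\{i_1,i_2\}:q$, $\{i_1,i_2\}:\neg q$; (ML dep) from $\{i_1,i_2\}:{=}(\varphi_1,\dots,\varphi_n,\psi)$: one alternative per $h:\{1,\dots,n\}\to\{\top,\bot\}$ adding $\{i_1\}:\varphi_m^{h(m)},\{i_2\}:\varphi_m^{h(m)}$ ($m\le n$), $\{i_1,i_2\}:\psi$, $\{i_1,i_2\}:\psi^\bot$;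 ($\Diamond$) from $\{i_1,\dots,i_n\}:\Diamond\varphi$ and $i_1\mathsf{R}j_1,\dots,i_n\mathsf{R}j_n$ on the branch: add $\{j_1,\dots,j_n\}:\varphi$; ($\Box$) from $\alpha:\Box\varphi$: let $t=2^{\mathrm{vrank}(\varphi)}$ and $i_1,\dots,i_t$ fresh distinct numbers; one alternative for each function $f:\{1,\dots,t\}\to\alpha$, adding $f(1)\mathsf{R}i_1,\dots,f(t)\mathsf{R}i_t$ and $\{i_1,\dots,i_t\}:\varphi$. Calculi: $\mathbf{T}_{\mathrm{ML}}$ = (Prop),($\neg$Prop),($\wedge$),($\vee$),($\Diamond$),($\Box$); $\mathbf{T}_{\mathrm{ML}(\underline{\vee})}$ = $\mathbf{T}_{\mathrm{ML}}$ + ($\underline{\vee}$); $\mathbf{T}_{\mathrm{MDL}}$ = $\mathbf{T}_{\mathrm{ML}}$ + (Split) + (PL dep); $\mathbf{T}_{\mathrm{EMDL}}$ = $\mathbf{T}_{\mathrm{ML}}$ + (Split) + (ML dep). A tableau for $\varphi$ in $\mathbf{T}_{\mathcal{L}}$ has root $\{1,\dots,2^{\mathrm{vrank}(\varphi)}\}:\varphi$ and uses rules of $\mathbf{T}_{\mathcal{L}}$. -}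

module Defs where

open import Data.Nat using (ℕ; zero; suc; _+_; _*_; _^_; _≟_)
open import Data.Bool using (Bool; true; false)
open import Data.Fin using (Fin)
open import Data.List using (List; []; _∷_; _++_; [_]; map; filter; length; lookup; tabulate; concat; upTo)
open import Data.List.Membership.Propositional using (_∈_; _∉_)
open import Data.List.Membership.DecPropositional _≟_ using (_∈?_)
open import Data.List.Relation.Unary.All using (All)
open import Data.Product using (Σ; _×_; _,_; ∃; ∃-syntax)
open import Data.Sum using (_⊎_)
open import Data.Empty using (⊥)
open import Function.Bundles using (_⇔_)
open import Function.Definitions using (Injective)
open import Relation.Nullary using (¬_)
open import Relation.Nullary.Decidable using (¬?)
open import Relation.Binary.PropositionalEquality using (_≡_; _≢_)
open import Induction.WellFounded using (Acc)

-- Formulas (negation normal form), one datatype for all four logics.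
-- Proposition symbols are natural numbers.

infixr 6 _∧_
infixr 5 _∨_ _∨ᵢ_

data Fml : Set where
  pos  : ℕ → Fml
  neg  : ℕ → Fml
  _∧_  : Fml → Fml → Fml
  _∨_  : Fml → Fml → Fml         -- (split / tensor) disjunction
  _∨ᵢ_ : Fml → Fml → Fml         -- intuitionistic disjunction  ∨̲
  ◇    : Fml → Fml
  □    : Fml → Fml
  dep  : List Fml → Fml → Fml    -- =(φ₁,…,φₙ,ψ)

data IsML : Fml → Set where
  pos : ∀ {p} → IsML (pos p)
  neg : ∀ {p} → IsML (neg p)
  and : ∀ {φ ψ} → IsML φ → IsML ψ → IsML (φ ∧ ψ)
  or  : ∀ {φ ψ} → IsML φ → IsML ψ → IsML (φ ∨ ψ)
  dia : ∀ {φ} → IsML φ → IsML (◇ φ)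
  box : ∀ {φ} → IsML φ → IsML (□ φ)

data IsProp : Fml → Set where
  prop : ∀ {p} → IsProp (pos p)

data Logic : Set where
  ML MLv MDL EMDL : Logic

data _-formula_ : Logic → Fml → Set where
  pos  : ∀ {L p} → L -formula pos p
  neg  : ∀ {L p} → L -formula neg p
  and  : ∀ {L φ ψ} → L -formula φ → L -formula ψ → L -formula (φ ∧ ψ)
  or   : ∀ {L φ ψ} → L -formula φ → L -formula ψ → L -formula (φ ∨ ψ)
  dia  : ∀ {L φ} → L -formula φ → L -formula (◇ φ)
  box  : ∀ {L φ} → L -formula φ → L -formula (□ φ)
  ior  : ∀ {φ ψ} → MLv -formula φ → MLv -formula ψ → MLv -formula (φ ∨ᵢ ψ)
  pdep : ∀ {xs y} → All IsProp xs → IsProp y → MDL -formula (dep xs y)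
  edep : ∀ {xs y} → All IsML xs → IsML y → EMDL -formula (dep xs y)

-- χ^⊥ : negation normal form of ¬χ.  Only ever applied to ML formulas;
-- the clauses for ∨ᵢ and dep are irrelevant fill-ins.
dual : Fml → Fml
dual (pos p)  = neg p
dual (neg p)  = pos p
dual (φ ∧ ψ)  = dual φ ∨ dual ψ
dual (φ ∨ ψ)  = dual φ ∧ dual ψ
dual (φ ∨ᵢ ψ) = φ ∨ᵢ ψ
dual (◇ φ)    = □ (dual φ)
dual (□ φ)    = ◇ (dual φ)
dual (dep xs y) = dep xs y

_^ᵇ_ : Fml → Bool → Fml
χ ^ᵇ true  = χ
χ ^ᵇ false = dual χ

-- vrank: number of ∨̲ after replacing =(φ₁..φₙ,ψ) by
--   ⋁_{a ∈ {⊥,⊤}ⁿ} ⋀ {φ₁^{a₁},…,φₙ^{aₙ}, ψ ∨̲ ψ^⊥}.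
-- Each of the 2ⁿ disjuncts contributes  Σᵢ vrank φᵢ + 1 + vrank ψ + vrank ψ^⊥
-- (using vrank χ^⊥ = vrank χ, valid for all χ in ML, the only case arising).
mutual
  vrank : Fml → ℕ
  vrank (pos p)    = 0
  vrank (neg p)    = 0
  vrank (φ ∧ ψ)    = vrank φ + vrank ψ
  vrank (φ ∨ ψ)    = vrank φ + vrank ψ
  vrank (φ ∨ᵢ ψ)   = suc (vrank φ + vrank ψ)
  vrank (◇ φ)      = vrank φ
  vrank (□ φ)      = vrank φ
  vrank (dep xs y) = 2 ^ length xs * (vrankL xs + suc (vrank y + vrank y))

  vrankL : List Fml → ℕ
  vrankL []       = 0
  vrankL (x ∷ xs) = vrank x + vrankL xs

-- Labels: finite subsets of ℕ, represented by lists, compared as sets.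

Label : Set
Label = List ℕ

_≈ˡ_ : Label → Label → Set
α ≈ˡ β = ∀ n → (n ∈ α) ⇔ (n ∈ β)

_⊆ˡ_ : Label → Label → Set
β ⊆ˡ α = ∀ n → n ∈ β → n ∈ α

_∖_ : Label → Label → Label
α ∖ β = filter (λ n → ¬? (n ∈? β)) α

data Item : Set where
  lab : Label → Fml → Item
  acc : ℕ → ℕ → Item

-- A branch: the list of items on it, plus the labeled formulas to which
-- rule (□) has already been applied on this branch.
record Branch : Set where
  constructor branch
  field
    items : List Item
    boxed : List (Label × Fml)
open Branch public

OnBranch : Label → Fml → Branch → Set
OnBranch α φ B = ∃[ β ] (lab β φ ∈ items B × β ≈ˡ α)

BoxUsed : Label → Fml → Branch → Set
BoxUsed α φ B = ∃[ β ] ((β , φ) ∈ boxed B × β ≈ˡ α)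

Occurs : ℕ → Branch → Set
Occurs n B = (∃[ α ] ∃[ φ ] (lab α φ ∈ items B × n ∈ α))
           ⊎ (∃[ j ] (acc n j ∈ items B))
           ⊎ (∃[ i ] (acc i n ∈ items B))

-- Items already on the branch as labeled formulas (a labeled formula is
-- never added to a branch already containing it).
Redundant : Branch → Item → Set
Redundant B (lab α φ) = OnBranch α φ B
Redundant B (acc i j) = ⊥

-- Adding the items of alternative A to branch B actually adds the list N:
-- N consists of items of A, contains every non-redundant item of A,
-- contains no redundant item, and is nonempty (the branch really grows).
record Adds (B : Branch) (A N : List Item) : Set where
  field
    fromA     : ∀ {x} → x ∈ N → x ∈ A
    complete  : ∀ {x} → x ∈ A → x ∈ N ⊎ Redundant B x
    fresh     : ∀ {x} → x ∈ N → ¬ Redundant B x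
    nonempty  : N ≢ []

-- items added by (PL dep)/(ML dep) for the choice g, premise {i₁,i₂}:=(xs,ψ)
depItems : ℕ → ℕ → (xs : List Fml) → (Fin (length xs) → Bool) → Fml → List Item
depItems i₁ i₂ xs g ψ =
  concat (tabulate (λ m → lab [ i₁ ] (lookup xs m ^ᵇ g m)
                        ∷ lab [ i₂ ] (lookup xs m ^ᵇ g m) ∷ []))
  ++ lab (i₁ ∷ i₂ ∷ []) ψ ∷ lab (i₁ ∷ i₂ ∷ []) (dual ψ) ∷ []

-- Alternatives A of the non-(□) rules of T_L applicable on branch B.
data RuleAlt (L : Logic) (B : Branch) : List Item → Set where
  prop  : ∀ {α p i} → lab α (pos p) ∈ items B → i ∈ α →
          RuleAlt L B [ lab [ i ] (pos p) ]
  nprop : ∀ {α p i} → lab α (neg p) ∈ items B → i ∈ α →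
          RuleAlt L B [ lab [ i ] (neg p) ]
  andˡ  : ∀ {α φ ψ} → lab α (φ ∧ ψ) ∈ items B → RuleAlt L B [ lab α φ ]
  andʳ  : ∀ {α φ ψ} → lab α (φ ∧ ψ) ∈ items B → RuleAlt L B [ lab α ψ ]
  orˡ   : ∀ {α φ ψ} → lab α (φ ∨ ψ) ∈ items B → (β : Label) → β ⊆ˡ α →
          RuleAlt L B [ lab β φ ]
  orʳ   : ∀ {α φ ψ} → lab α (φ ∨ ψ) ∈ items B → (β : Label) → β ⊆ˡ α →
          RuleAlt L B [ lab (α ∖ β) ψ ]
  ior   : ∀ {α φ ψ} → L ≡ MLv → lab α (φ ∨ᵢ ψ) ∈ items B →
          RuleAlt L B (lab α φ ∷ lab α ψ ∷ [])
  split : ∀ {α xs ψ i j} → (L ≡ MDL ⊎ L ≡ EMDL) → lab α (dep xs ψ) ∈ items B →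
          i ∈ α → j ∈ α → i ≢ j →
          RuleAlt L B [ lab (i ∷ j ∷ []) (dep xs ψ) ]
  pldep : ∀ {α xs ψ i₁ i₂} → L ≡ MDL → lab α (dep xs ψ) ∈ items B →
          α ≈ˡ (i₁ ∷ i₂ ∷ []) → All IsProp xs → IsProp ψ →
          (g : Fin (length xs) → Bool) →
          RuleAlt L B (depItems i₁ i₂ xs g ψ)
  mldep : ∀ {α xs ψ i₁ i₂} → L ≡ EMDL → lab α (dep xs ψ) ∈ items B →
          α ≈ˡ (i₁ ∷ i₂ ∷ []) →
          (h : Fin (length xs) → Bool) →
          RuleAlt L B (depItems i₁ i₂ xs h ψ)
  dia   : ∀ {α φ} → lab α (◇ φ) ∈ items B →
          (g : ℕ → ℕ) → (∀ i → i ∈ α → acc i (g i) ∈ items B) →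
          RuleAlt L B [ lab (map g α) φ ]

boxItems : ∀ {t} → (Fin t → ℕ) → (Fin t → ℕ) → Fml → List Item
boxItems f fr φ = tabulate (λ k → acc (f k) (fr k)) ++ [ lab (tabulate fr) φ ]

data Step (L : Logic) (B : Branch) : Branch → Set where
  rule : ∀ {A N} → RuleAlt L B A → Adds B A N →
         Step L B (branch (items B ++ N) (boxed B))
  box  : ∀ {α φ N} → lab α (□ φ) ∈ items B → ¬ BoxUsed α (□ φ) B →
         (fr : Fin (2 ^ vrank φ) → ℕ) → Injective _≡_ _≡_ fr →
         (∀ k → ¬ Occurs (fr k) B) →
         (f : Fin (2 ^ vrank φ) → ℕ) → (∀ k → f k ∈ α) →
         Adds B (boxItems f fr φ) N →
         Step L B (branch (items B ++ N) ((α , □ φ) ∷ boxed B))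

root : Fml → Branch
root φ = branch [ lab (map suc (upTo (2 ^ vrank φ))) φ ] []

_⊏[_]_ : Branch → Logic → Branch → Set
B' ⊏[ L ] B = Step L B B'

-- Every tableau for φ in T_L is finite: the step relation is well-founded
-- from the root, i.e. every branch of every tableau is finite
-- (tableaux are finitely branching).
AllTableauxFinite : Logic → Fml → Set
AllTableauxFinite L φ = Acc (λ B' B → B' ⊏[ L ] B) (root φ)

-- Give every number on a branch a level: its distance, along R, from the root numbers. On every
-- branch each labelled formula α : ψ has all of α at a single level d, with d + md ψ ≤ md φ and
-- ψ a subformula of φ or the dual of one. So over the numbers present at level d only finitely
-- many labelled formulas (labels up to set equality) and applications of (□) can ever be
-- recorded. Each rule application records a new one at some level d ≤ md φ, and introduces
-- fresh numbers only at level d + 1, leaving levels 0, …, d untouched. Branches therefore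
-- increase in a lexicographic order over levels 0, …, md φ of sets bounded by finite
-- universes, and that order is well founded.

{-# OPTIONS --safe #-}
module Submission where

open import Defs
open import Data.Bool using (Bool; true; false; not; if_then_else_)
open import Data.Empty using (⊥; ⊥-elim)
open import Data.Fin using (Fin)
open import Data.List
  using (List; []; _∷_; _++_; [_]; map; filter; length; lookup; tabulate; upTo;
         cartesianProduct; cartesianProductWith)
open import Data.List.Membership.Propositional using (_∈_; _∉_)
open import Data.List.Membership.Propositional.Properties
  using (∈-++⁺ˡ; ∈-++⁺ʳ; ∈-++⁻; ∈-map⁺; ∈-map⁻; ∈-filter⁺; ∈-filter⁻; ∈-tabulate⁺; ∈-tabulate⁻;
         ∈-lookup; ∈-cartesianProduct⁺; ∈-cartesianProductWith⁺)
open import Data.List.Properties using (filter-++; filter-none; filter-accept; filter-reject)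
open import Data.List.Relation.Binary.Subset.Propositional using (_⊆_)
open import Data.List.Relation.Binary.Subset.Propositional.Properties using (∈-∷⁺ʳ; filter-⊆)
open import Data.List.Relation.Unary.All using (All; []; _∷_)
import Data.List.Relation.Unary.All as All
open import Data.List.Relation.Unary.All.Properties using (++⁺; concat⁺; tabulate⁺)
open import Data.List.Relation.Unary.Any using (here; there)
open import Data.Nat using (ℕ; zero; suc; _+_; _≤_; _<_; _⊔_; _≟_; _^_; z≤n; s≤s)
open import Data.List.Membership.DecPropositional _≟_ using (_∈?_)
open import Data.Nat.Properties
  using (≤-refl; ≤-trans; ≤-reflexive; <⇒≤; <⇒≢; <⇒≱; m≤n⇒m<n∨m≡n; n≤1+n; m≤m⊔n; m≤n⊔m; m≤m+n;
         +-suc; +-identityʳ; +-monoʳ-≤)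
open import Data.Product using (∃; ∃-syntax; _×_; _,_; proj₁; proj₂)
open import Data.Sum using (_⊎_; inj₁; inj₂) renaming ([_,_] to either)
open import Function using (_∘_; id)
open import Function.Bundles using (Equivalence; mk⇔; _⇔_)
open import Function.Construct.Composition using (_⇔-∘_)
open import Function.Construct.Identity using (⇔-id)
open import Function.Construct.Symmetry using (⇔-sym)
open import Induction.WellFounded using (Acc; acc; WellFounded; module Subrelation)
open import Relation.Binary.Construct.Closure.ReflexiveTransitive using (Star; ε; _◅_)
open import Relation.Binary.PropositionalEquality
  using (_≡_; refl; sym; trans; cong; cong₂; subst; module ≡-Reasoning)
open import Relation.Nullary using (¬_; yes; no; does; ¬?)
open import Relation.Unary using (Decidable)

module _ {X : Set} where

  _⊋[_]_ : (X → Set) → List X → (X → Set) → Set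
  Q ⊋[ U ] P = (∀ {x} → P x → Q x) × ∃[ x ] x ∈ U × Q x × ¬ P x

  ⊋-weakenʳ : ∀ {P P′ Q U} → (∀ {x} → P x → P′ x) → Q ⊋[ U ] P′ → Q ⊋[ U ] P
  ⊋-weakenʳ P⊆P′ (P′⊆Q , x , x∈U , Qx , ¬P′x) = P′⊆Q ∘ P⊆P′ , x , x∈U , Qx , ¬P′x ∘ P⊆P′

  ⊋-wellFounded : ∀ U → WellFounded (_⊋[ U ]_)
  ⊋-wellFounded []      P = acc λ { (_ , _ , () , _) }
  ⊋-wellFounded (u ∷ U) P = acc-∷ (⊋-wellFounded U P)
    where
    -- Once u is covered it stays covered, so every further extension is witnessed in U.
    acc-∷-∋ : ∀ {P} → Acc (_⊋[ U ]_) P → P u → Acc (_⊋[ u ∷ U ]_) P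
    acc-∷-∋ (acc rec) Pu = acc λ
      { (_ , _ , here refl , _ , ¬Pu) → ⊥-elim (¬Pu Pu)
      ; (P⊆Q , x , there x∈U , Qx , ¬Px) → acc-∷-∋ (rec (P⊆Q , x , x∈U , Qx , ¬Px)) (P⊆Q Pu)
      }

    acc-∷ : ∀ {P} → Acc (_⊋[ U ]_) P → Acc (_⊋[ u ∷ U ]_) P
    acc-∷ (acc rec) = acc λ
      { {Q} (_ , _ , here refl , Qu , _) → acc-∷-∋ (⊋-wellFounded U Q) Qu
      ; (P⊆Q , x , there x∈U , Qx , ¬Px) → acc-∷ (rec (P⊆Q , x , x∈U , Qx , ¬Px))
      }

module LayeredGrowth {S X : Set} (Covered : S → X → Set) (universe : ℕ → S → List X) (height : ℕ) where

  record GrowsAt (s′ s : S) (e : ℕ) : Set where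
    field
      below-height    : e < height
      universe-stable : ∀ {e′} → e′ ≤ e → universe e′ s′ ≡ universe e′ s
      grows           : Covered s′ ⊋[ universe e s ] Covered s
  open GrowsAt

  Grows : S → S → Set
  Grows s′ s = ∃ (GrowsAt s′ s)

  GrowsFrom : ℕ → S → S → Set
  GrowsFrom d s′ s = ∃[ e ] d ≤ e × GrowsAt s′ s e

  growsFrom-split : ∀ {d s′ s} → GrowsFrom d s′ s → GrowsFrom (suc d) s′ s ⊎ GrowsAt s′ s d
  growsFrom-split (e , d≤e , g) with m≤n⇒m<n∨m≡n d≤e
  ... | inj₁ d<e  = inj₁ (e , d<e , g)
  ... | inj₂ refl = inj₂ g

  growsFrom-stable : ∀ {d s′ s} → GrowsFrom (suc d) s′ s → universe d s′ ≡ universe d s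
  growsFrom-stable (_ , d<e , g) = universe-stable g (<⇒≤ d<e)

  growsFrom-mono : ∀ {d s′ s x} → GrowsFrom d s′ s → Covered s x → Covered s′ x
  growsFrom-mono (_ , _ , g) = proj₁ (grows g)

  growsFrom-lower : ∀ {d} → WellFounded (GrowsFrom (suc d)) → WellFounded (GrowsFrom d)
  growsFrom-lower {d} wf-above s₀ = go (⊋-wellFounded U (Covered s₀)) refl id (wf-above s₀)
    where
    U : List X
    U = universe d s₀

    -- Lexicographic: either the covered part P of U grows, or U is untouched and the step is above d.
    go : ∀ {P s} → Acc (_⊋[ U ]_) P → universe d s ≡ U → (∀ {x} → P x → Covered s x) →
         Acc (GrowsFrom (suc d)) s → Acc (GrowsFrom d) s
    go {s = s} accP@(acc larger) U≡ P⊆ (acc above) = acc λ {s′} step →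
      either (λ higher → go accP (trans (growsFrom-stable higher) U≡) (growsFrom-mono higher ∘ P⊆)
                            (above higher))
             (λ g → go (larger (⊋-weakenʳ P⊆ (subst (λ V → Covered s′ ⊋[ V ] Covered s) U≡ (grows g))))
                       (trans (universe-stable g ≤-refl) U≡) id (wf-above s′))
             (growsFrom-split step)

  growsFrom-wellFounded : ∀ k {d} → height ≤ k + d → WellFounded (GrowsFrom d)
  growsFrom-wellFounded zero h s =
    acc λ { (_ , d≤e , g) → ⊥-elim (<⇒≱ (below-height g) (≤-trans h d≤e)) }
  growsFrom-wellFounded (suc k) {d} h =
    growsFrom-lower (growsFrom-wellFounded k (subst (height ≤_) (sym (+-suc k d)) h))

  grows-wellFounded : WellFounded Grows
  grows-wellFounded =
    Subrelation.wellFounded (λ (e , g) → e , z≤n , g)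
      (growsFrom-wellFounded height (≤-reflexive (sym (+-identityʳ height))))

acc-annotated : {A C : Set} {_<_ : A → A → Set} {_⊏_ : A × C → A × C → Set} (Inv : A → C → Set) →
                (∀ {a a′ c} → Inv a c → a′ < a → ∃[ c′ ] Inv a′ c′ × (a′ , c′) ⊏ (a , c)) →
                ∀ {a c} → Inv a c → Acc _⊏_ (a , c) → Acc _<_ a
acc-annotated Inv lift inv (acc rec) =
  acc λ a′<a → let (c′ , inv′ , lt) = lift inv a′<a in acc-annotated Inv lift inv′ (rec lt)

dual-involutive : ∀ φ → dual (dual φ) ≡ φ
dual-involutive (pos p)    = refl
dual-involutive (neg p)    = refl
dual-involutive (φ ∧ ψ)    = cong₂ _∧_ (dual-involutive φ) (dual-involutive ψ)
dual-involutive (φ ∨ ψ)    = cong₂ _∨_ (dual-involutive φ) (dual-involutive ψ)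
dual-involutive (φ ∨ᵢ ψ)   = refl
dual-involutive (◇ φ)      = cong ◇ (dual-involutive φ)
dual-involutive (□ φ)      = cong □ (dual-involutive φ)
dual-involutive (dep xs ψ) = refl

dual-^ᵇ : ∀ φ b → dual (φ ^ᵇ b) ≡ φ ^ᵇ not b
dual-^ᵇ φ true  = refl
dual-^ᵇ φ false = dual-involutive φ

infix 4 _≺_ _≼_

data _≺_ : Fml → Fml → Set where
  ∧ˡ      : ∀ {φ ψ} → φ ≺ φ ∧ ψ
  ∧ʳ      : ∀ {φ ψ} → ψ ≺ φ ∧ ψ
  ∨ˡ      : ∀ {φ ψ} → φ ≺ φ ∨ ψ
  ∨ʳ      : ∀ {φ ψ} → ψ ≺ φ ∨ ψ
  ∨ᵢˡ     : ∀ {φ ψ} → φ ≺ φ ∨ᵢ ψ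
  ∨ᵢʳ     : ∀ {φ ψ} → ψ ≺ φ ∨ᵢ ψ
  under-◇ : ∀ {φ} → φ ≺ ◇ φ
  under-□ : ∀ {φ} → φ ≺ □ φ
  dep-arg : ∀ {xs ψ χ} → χ ∈ xs → χ ≺ dep xs ψ
  dep-res : ∀ {xs ψ} → ψ ≺ dep xs ψ

_≼_ : Fml → Fml → Set
_≼_ = Star _≺_

≺-^ᵇ : ∀ {χ} φ b → χ ≺ φ ^ᵇ b → ∃[ χ′ ] ∃[ b′ ] χ′ ≺ φ × χ ≡ χ′ ^ᵇ b′
≺-^ᵇ φ          true  r       = _ , true , r , refl
≺-^ᵇ (φ ∧ ψ)    false ∨ˡ      = φ , false , ∧ˡ , refl
≺-^ᵇ (φ ∧ ψ)    false ∨ʳ      = ψ , false , ∧ʳ , refl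
≺-^ᵇ (φ ∨ ψ)    false ∧ˡ      = φ , false , ∨ˡ , refl
≺-^ᵇ (φ ∨ ψ)    false ∧ʳ      = ψ , false , ∨ʳ , refl
≺-^ᵇ (φ ∨ᵢ ψ)   false r       = _ , true , r , refl
≺-^ᵇ (◇ φ)      false under-□ = φ , false , under-◇ , refl
≺-^ᵇ (□ φ)      false under-◇ = φ , false , under-□ , refl
≺-^ᵇ (dep xs ψ) false r       = _ , true , r , refl

mutual
  subformulas : Fml → List Fml
  subformulas φ = φ ∷ properSubformulas φ

  properSubformulas : Fml → List Fml
  properSubformulas (pos p)    = []
  properSubformulas (neg p)    = []
  properSubformulas (φ ∧ ψ)    = subformulas φ ++ subformulas ψ
  properSubformulas (φ ∨ ψ)    = subformulas φ ++ subformulas ψ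
  properSubformulas (φ ∨ᵢ ψ)   = subformulas φ ++ subformulas ψ
  properSubformulas (◇ φ)      = subformulas φ
  properSubformulas (□ φ)      = subformulas φ
  properSubformulas (dep xs ψ) = subformulasᴸ xs ++ subformulas ψ

  subformulasᴸ : List Fml → List Fml
  subformulasᴸ []       = []
  subformulasᴸ (φ ∷ φs) = subformulas φ ++ subformulasᴸ φs

subformulasᴸ-⊇ : ∀ {χ xs} → χ ∈ xs → subformulas χ ⊆ subformulasᴸ xs
subformulasᴸ-⊇ (here refl)             = ∈-++⁺ˡ
subformulasᴸ-⊇ {xs = φ ∷ _} (there χ∈) = ∈-++⁺ʳ (subformulas φ) ∘ subformulasᴸ-⊇ χ∈

≺-subformulas : ∀ {χ φ} → χ ≺ φ → subformulas χ ⊆ subformulas φ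
≺-subformulas ∧ˡ              = there ∘ ∈-++⁺ˡ
≺-subformulas (∧ʳ {φ})        = there ∘ ∈-++⁺ʳ (subformulas φ)
≺-subformulas ∨ˡ              = there ∘ ∈-++⁺ˡ
≺-subformulas (∨ʳ {φ})        = there ∘ ∈-++⁺ʳ (subformulas φ)
≺-subformulas ∨ᵢˡ             = there ∘ ∈-++⁺ˡ
≺-subformulas (∨ᵢʳ {φ})       = there ∘ ∈-++⁺ʳ (subformulas φ)
≺-subformulas under-◇         = there
≺-subformulas under-□         = there
≺-subformulas (dep-arg χ∈)    = there ∘ ∈-++⁺ˡ ∘ subformulasᴸ-⊇ χ∈
≺-subformulas (dep-res {xs})  = there ∘ ∈-++⁺ʳ (subformulasᴸ xs)

≼-subformulas : ∀ {χ φ} → χ ≼ φ → subformulas χ ⊆ subformulas φ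
≼-subformulas ε        = id
≼-subformulas (r ◅ rs) = ≼-subformulas rs ∘ ≺-subformulas r

≼⇒∈subformulas : ∀ {χ φ} → χ ≼ φ → χ ∈ subformulas φ
≼⇒∈subformulas χ≼φ = ≼-subformulas χ≼φ (here refl)

mutual
  modalDepth : Fml → ℕ
  modalDepth (pos p)    = 0
  modalDepth (neg p)    = 0
  modalDepth (φ ∧ ψ)    = modalDepth φ ⊔ modalDepth ψ
  modalDepth (φ ∨ ψ)    = modalDepth φ ⊔ modalDepth ψ
  modalDepth (φ ∨ᵢ ψ)   = modalDepth φ ⊔ modalDepth ψ
  modalDepth (◇ φ)      = suc (modalDepth φ)
  modalDepth (□ φ)      = suc (modalDepth φ)
  modalDepth (dep xs ψ) = modalDepthᴸ xs ⊔ modalDepth ψ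

  modalDepthᴸ : List Fml → ℕ
  modalDepthᴸ []       = 0
  modalDepthᴸ (φ ∷ φs) = modalDepth φ ⊔ modalDepthᴸ φs

modalDepth-dual : ∀ φ → modalDepth (dual φ) ≡ modalDepth φ
modalDepth-dual (pos p)    = refl
modalDepth-dual (neg p)    = refl
modalDepth-dual (φ ∧ ψ)    = cong₂ _⊔_ (modalDepth-dual φ) (modalDepth-dual ψ)
modalDepth-dual (φ ∨ ψ)    = cong₂ _⊔_ (modalDepth-dual φ) (modalDepth-dual ψ)
modalDepth-dual (φ ∨ᵢ ψ)   = refl
modalDepth-dual (◇ φ)      = cong suc (modalDepth-dual φ)
modalDepth-dual (□ φ)      = cong suc (modalDepth-dual φ)
modalDepth-dual (dep xs ψ) = refl

modalDepthᴸ-∈ : ∀ {χ xs} → χ ∈ xs → modalDepth χ ≤ modalDepthᴸ xs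
modalDepthᴸ-∈ {xs = φ ∷ φs} (here refl) = m≤m⊔n (modalDepth φ) (modalDepthᴸ φs)
modalDepthᴸ-∈ {xs = φ ∷ φs} (there χ∈)  = ≤-trans (modalDepthᴸ-∈ χ∈) (m≤n⊔m (modalDepth φ) (modalDepthᴸ φs))

≺-modalDepth : ∀ {χ φ} → χ ≺ φ → modalDepth χ ≤ modalDepth φ
≺-modalDepth (∧ˡ {φ} {ψ})          = m≤m⊔n (modalDepth φ) (modalDepth ψ)
≺-modalDepth (∧ʳ {φ} {ψ})          = m≤n⊔m (modalDepth φ) (modalDepth ψ)
≺-modalDepth (∨ˡ {φ} {ψ})          = m≤m⊔n (modalDepth φ) (modalDepth ψ)
≺-modalDepth (∨ʳ {φ} {ψ})          = m≤n⊔m (modalDepth φ) (modalDepth ψ)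
≺-modalDepth (∨ᵢˡ {φ} {ψ})         = m≤m⊔n (modalDepth φ) (modalDepth ψ)
≺-modalDepth (∨ᵢʳ {φ} {ψ})         = m≤n⊔m (modalDepth φ) (modalDepth ψ)
≺-modalDepth (under-◇ {φ})         = n≤1+n (modalDepth φ)
≺-modalDepth (under-□ {φ})         = n≤1+n (modalDepth φ)
≺-modalDepth (dep-arg {xs} {ψ} χ∈) = ≤-trans (modalDepthᴸ-∈ χ∈) (m≤m⊔n (modalDepthᴸ xs) (modalDepth ψ))
≺-modalDepth (dep-res {xs} {ψ})    = m≤n⊔m (modalDepthᴸ xs) (modalDepth ψ)

sublists : {A : Set} → List A → List (List A)
sublists []       = [ [] ]
sublists (x ∷ xs) = map (x ∷_) (sublists xs) ++ sublists xs

filter-∈-sublists : {A : Set} {P : A → Set} (P? : Decidable P) (xs : List A) → filter P? xs ∈ sublists xs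
filter-∈-sublists P? []       = here refl
filter-∈-sublists P? (x ∷ xs) with does (P? x)
... | true  = ∈-++⁺ˡ (∈-map⁺ (x ∷_) (filter-∈-sublists P? xs))
... | false = ∈-++⁺ʳ (map (x ∷_) (sublists xs)) (filter-∈-sublists P? xs)

sublists-complete : ∀ {α ns} → α ⊆ ns → ∃[ β ] β ∈ sublists ns × β ≈ˡ α
sublists-complete {α} {ns} α⊆ns =
  filter (_∈? α) ns , filter-∈-sublists (_∈? α) ns ,
  λ n → mk⇔ (proj₂ ∘ ∈-filter⁻ (_∈? α) {xs = ns}) (λ n∈α → ∈-filter⁺ (_∈? α) (α⊆ns n∈α) n∈α)

≈ˡ-refl : ∀ {α} → α ≈ˡ α
≈ˡ-refl {α} n = ⇔-id (n ∈ α)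

≈ˡ-sym : ∀ {α β} → α ≈ˡ β → β ≈ˡ α
≈ˡ-sym α≈β n = ⇔-sym (α≈β n)

≈ˡ-trans : ∀ {α β γ} → α ≈ˡ β → β ≈ˡ γ → α ≈ˡ γ
≈ˡ-trans α≈β β≈γ n = β≈γ n ⇔-∘ α≈β n

data Mark : Set where
  onBranch expanded : Mark

marks : List Mark
marks = onBranch ∷ expanded ∷ []

∈-marks : ∀ m → m ∈ marks
∈-marks onBranch = here refl
∈-marks expanded = there (here refl)

Covered : Branch → Mark × Label × Fml → Set
Covered B (onBranch , α , ψ) = OnBranch α ψ B
Covered B (expanded , α , ψ) = BoxUsed α ψ B

Covered-mono : ∀ {B B′ x} → items B ⊆ items B′ → boxed B ⊆ boxed B′ → Covered B x → Covered B′ x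
Covered-mono {x = onBranch , _} items⊆ _ (γ , γ∈ , γ≈) = γ , items⊆ γ∈ , γ≈
Covered-mono {x = expanded , _} _ boxed⊆ (γ , γ∈ , γ≈) = γ , boxed⊆ γ∈ , γ≈

Covered-resp-≈ˡ : ∀ {B m α β ψ} → β ≈ˡ α → Covered B (m , α , ψ) → Covered B (m , β , ψ)
Covered-resp-≈ˡ {m = onBranch} β≈α (γ , γ∈ , γ≈α) = γ , γ∈ , ≈ˡ-trans γ≈α (≈ˡ-sym β≈α)
Covered-resp-≈ˡ {m = expanded} β≈α (γ , γ∈ , γ≈α) = γ , γ∈ , ≈ˡ-trans γ≈α (≈ˡ-sym β≈α)

Occurs-mono : ∀ {B B′ n} → items B ⊆ items B′ → Occurs n B → Occurs n B′
Occurs-mono items⊆ (inj₁ (α , φ , x∈ , n∈α)) = inj₁ (α , φ , items⊆ x∈ , n∈α)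
Occurs-mono items⊆ (inj₂ (inj₁ (j , x∈)))    = inj₂ (inj₁ (j , items⊆ x∈))
Occurs-mono items⊆ (inj₂ (inj₂ (i , x∈)))    = inj₂ (inj₂ (i , items⊆ x∈))

-- level n is the length of an R-path from a root number to n
record Levels : Set where
  field
    level   : ℕ → ℕ
    numbers : List ℕ
open Levels

numbersAt : ℕ → Levels → List ℕ
numbersAt e W = filter (λ n → level W n ≟ e) (numbers W)

introduce : List ℕ → ℕ → Levels → Levels
introduce ns e W = record
  { level   = λ n → if does (n ∈? ns) then e else level W n
  ; numbers = ns ++ numbers W
  }

level-introduced : ∀ {n ns e W} → n ∈ ns → level (introduce ns e W) n ≡ e
level-introduced {n} {ns} n∈ns with n ∈? ns
... | yes _   = refl
... | no n∉ns = ⊥-elim (n∉ns n∈ns)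

level-kept : ∀ {n ns e W} → n ∉ ns → level (introduce ns e W) n ≡ level W n
level-kept {n} {ns} n∉ns with n ∈? ns
... | yes n∈ns = ⊥-elim (n∉ns n∈ns)
... | no _     = refl

filter-cong-∈ : ∀ {A : Set} {P Q : A → Set} (P? : Decidable P) (Q? : Decidable Q) {xs : List A} →
                (∀ {x} → x ∈ xs → P x ⇔ Q x) → filter P? xs ≡ filter Q? xs
filter-cong-∈ P? Q? {[]}     P⇔Q = refl
filter-cong-∈ P? Q? {x ∷ xs} P⇔Q with Q? x
... | yes Qx = begin
  filter P? (x ∷ xs)  ≡⟨ filter-accept P? (Equivalence.from (P⇔Q (here refl)) Qx) ⟩
  x ∷ filter P? xs    ≡⟨ cong (x ∷_) (filter-cong-∈ P? Q? (P⇔Q ∘ there)) ⟩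
  x ∷ filter Q? xs    ∎
  where open ≡-Reasoning
... | no ¬Qx = begin
  filter P? (x ∷ xs)  ≡⟨ filter-reject P? (¬Qx ∘ Equivalence.to (P⇔Q (here refl))) ⟩
  filter P? xs        ≡⟨ filter-cong-∈ P? Q? (P⇔Q ∘ there) ⟩
  filter Q? xs        ∎
  where open ≡-Reasoning

numbersAt-introduce : ∀ {ns e e′ W} → (∀ {n} → n ∈ numbers W → n ∉ ns) → e′ < e →
                      numbersAt e′ (introduce ns e W) ≡ numbersAt e′ W
numbersAt-introduce {ns} {e} {e′} {W} old∉ns e′<e = begin
  filter P? (ns ++ numbers W)            ≡⟨ filter-++ P? ns (numbers W) ⟩
  filter P? ns ++ filter P? (numbers W)  ≡⟨ cong (_++ filter P? (numbers W)) none-new ⟩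
  filter P? (numbers W)                  ≡⟨ filter-cong-∈ P? Q? (λ n∈ → level-agrees (old∉ns n∈)) ⟩
  numbersAt e′ W                         ∎
  where
  open ≡-Reasoning
  P? : Decidable (λ n → level (introduce ns e W) n ≡ e′)
  P? n = level (introduce ns e W) n ≟ e′
  Q? : Decidable (λ n → level W n ≡ e′)
  Q? n = level W n ≟ e′
  none-new : filter P? ns ≡ []
  none-new = filter-none P? {xs = ns} (All.tabulate λ n∈ns ≡e′ → <⇒≢ e′<e (trans (sym ≡e′) (level-introduced {W = W} n∈ns)))
  level-agrees : ∀ {n} → n ∉ ns → (level (introduce ns e W) n ≡ e′) ⇔ (level W n ≡ e′)
  level-agrees n∉ns = mk⇔ (trans (sym (level-kept {W = W} n∉ns))) (trans (level-kept {W = W} n∉ns))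

module Termination (φ₀ : Fml) where

  Closure : Fml → Set
  Closure ψ = ∃[ χ ] ∃[ b ] χ ≼ φ₀ × ψ ≡ χ ^ᵇ b

  closure : List Fml
  closure = cartesianProductWith _^ᵇ_ (subformulas φ₀) (true ∷ false ∷ [])

  Closure⇒∈closure : ∀ {ψ} → Closure ψ → ψ ∈ closure
  Closure⇒∈closure (χ , b , χ≼φ₀ , refl) = ∈-cartesianProductWith⁺ _^ᵇ_ (≼⇒∈subformulas χ≼φ₀) (∈-bools b)
    where
    ∈-bools : ∀ b → b ∈ true ∷ false ∷ []
    ∈-bools true  = here refl
    ∈-bools false = there (here refl)

  Closure-≺ : ∀ {χ ψ} → χ ≺ ψ → Closure ψ → Closure χ
  Closure-≺ r (θ , b , θ≼φ₀ , refl) with ≺-^ᵇ θ b r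
  ... | χ′ , b′ , χ′≺θ , refl = χ′ , b′ , χ′≺θ ◅ θ≼φ₀ , refl

  Closure-^ᵇ : ∀ {ψ} → Closure ψ → ∀ b → Closure (ψ ^ᵇ b)
  Closure-^ᵇ c                     true  = c
  Closure-^ᵇ (θ , b , θ≼φ₀ , refl) false = θ , not b , θ≼φ₀ , dual-^ᵇ θ b

  Fits : ℕ → Fml → Set
  Fits d ψ = d + modalDepth ψ ≤ modalDepth φ₀ × Closure ψ

  Fits-≺ : ∀ {d χ ψ} → χ ≺ ψ → Fits d ψ → Fits d χ
  Fits-≺ {d} r (bound , c) = ≤-trans (+-monoʳ-≤ d (≺-modalDepth r)) bound , Closure-≺ r c

  Fits-◇ : ∀ {d ψ} → Fits d (◇ ψ) → Fits (suc d) ψ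
  Fits-◇ {d} {ψ} (bound , c) = subst (_≤ modalDepth φ₀) (+-suc d (modalDepth ψ)) bound , Closure-≺ under-◇ c

  Fits-□ : ∀ {d ψ} → Fits d (□ ψ) → Fits (suc d) ψ
  Fits-□ {d} {ψ} (bound , c) = subst (_≤ modalDepth φ₀) (+-suc d (modalDepth ψ)) bound , Closure-≺ under-□ c

  Fits-^ᵇ : ∀ {d ψ} → Fits d ψ → ∀ b → Fits d (ψ ^ᵇ b)
  Fits-^ᵇ fits                true  = fits
  Fits-^ᵇ {d} {ψ} (bound , c) false =
    subst (λ k → d + k ≤ modalDepth φ₀) (sym (modalDepth-dual ψ)) bound , Closure-^ᵇ c false

  AtLevel : Levels → ℕ → Label → Set
  AtLevel W d α = ∀ {i} → i ∈ α → i ∈ numbers W × level W i ≡ d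

  Placed : Levels → Label → Fml → Set
  Placed W α ψ = ∃[ d ] AtLevel W d α × Fits d ψ

  PlacedItem : Levels → Item → Set
  PlacedItem W (lab α ψ) = Placed W α ψ
  PlacedItem W (acc i j) = level W j ≡ suc (level W i) × j ∈ numbers W

  -- the rules other than (□) add no accessibility items
  PlacedFormula : Levels → Item → Set
  PlacedFormula W (lab α ψ) = Placed W α ψ
  PlacedFormula W (acc _ _) = ⊥

  PlacedFormula⇒PlacedItem : ∀ {W} x → PlacedFormula W x → PlacedItem W x
  PlacedFormula⇒PlacedItem (lab α ψ) p = p

  record Invariant (B : Branch) (W : Levels) : Set where
    field
      placed        : ∀ {x} → x ∈ items B → PlacedItem W x
      numbers-occur : ∀ {n} → n ∈ numbers W → Occurs n B
  open Invariant

  restrict : ∀ {W α β ψ} → β ⊆ α → Placed W α ψ → Placed W β ψ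
  restrict β⊆α (d , at , fits) = d , at ∘ β⊆α , fits

  single : ∀ {W α i ψ} → i ∈ α → Placed W α ψ → Placed W [ i ] ψ
  single i∈α = restrict (∈-∷⁺ʳ i∈α λ ())

  component : ∀ {W α χ ψ} → χ ≺ ψ → Placed W α ψ → Placed W α χ
  component r (d , at , fits) = d , at , Fits-≺ r fits

  successors : ∀ {B W α ψ g} → Invariant B W → (∀ i → i ∈ α → acc i (g i) ∈ items B) →
               Placed W α (◇ ψ) → Placed W (map g α) ψ
  successors {W = W} {α} {g = g} inv acc∈ (d , at , fits) = suc d , at-successor , Fits-◇ fits
    where
    at-successor : AtLevel W (suc d) (map g α)
    at-successor gi∈ with ∈-map⁻ g gi∈
    ... | i , i∈α , refl with placed inv (acc∈ i i∈α)
    ...   | level-step , gi∈W = gi∈W , trans level-step (cong suc (proj₂ (at i∈α)))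

  dependence-placed : ∀ {W α xs ψ i₁ i₂} (g : Fin (length xs) → Bool) → α ≈ˡ (i₁ ∷ i₂ ∷ []) →
                      Placed W α (dep xs ψ) → All (PlacedFormula W) (depItems i₁ i₂ xs g ψ)
  dependence-placed {W} {α} {xs} {ψ} {i₁} {i₂} g α≈ (d , at , fits) =
    ++⁺ (concat⁺ (tabulate⁺ λ m → single i₁∈α (argument m) ∷ single i₂∈α (argument m) ∷ []))
        (restrict pair⊆α (result true) ∷ restrict pair⊆α (result false) ∷ [])
    where
    pair⊆α : i₁ ∷ i₂ ∷ [] ⊆ α
    pair⊆α = Equivalence.from (α≈ _)
    i₁∈α : i₁ ∈ α
    i₁∈α = pair⊆α (here refl)
    i₂∈α : i₂ ∈ α
    i₂∈α = pair⊆α (there (here refl))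
    argument : ∀ m → Placed W α (lookup xs m ^ᵇ g m)
    argument m = d , at , Fits-^ᵇ (Fits-≺ (dep-arg (∈-lookup m)) fits) (g m)
    result : ∀ b → Placed W α (ψ ^ᵇ b)
    result b = d , at , Fits-^ᵇ (Fits-≺ dep-res fits) b

  alternative-placed : ∀ {L B W A} → Invariant B W → RuleAlt L B A → All (PlacedFormula W) A
  alternative-placed inv (prop x∈ i∈)          = single i∈ (placed inv x∈) ∷ []
  alternative-placed inv (nprop x∈ i∈)         = single i∈ (placed inv x∈) ∷ []
  alternative-placed inv (andˡ x∈)             = component ∧ˡ (placed inv x∈) ∷ []
  alternative-placed inv (andʳ x∈)             = component ∧ʳ (placed inv x∈) ∷ []
  alternative-placed inv (orˡ x∈ β β⊆α)        = restrict (β⊆α _) (component ∨ˡ (placed inv x∈)) ∷ []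
  alternative-placed inv (orʳ {α} x∈ β _)      =
    restrict (filter-⊆ (λ n → ¬? (n ∈? β)) α) (component ∨ʳ (placed inv x∈)) ∷ []
  alternative-placed inv (ior _ x∈)            =
    component ∨ᵢˡ (placed inv x∈) ∷ component ∨ᵢʳ (placed inv x∈) ∷ []
  alternative-placed inv (split _ x∈ i∈ j∈ _)  = restrict (∈-∷⁺ʳ i∈ (∈-∷⁺ʳ j∈ λ ())) (placed inv x∈) ∷ []
  alternative-placed inv (pldep _ x∈ α≈ _ _ g) = dependence-placed g α≈ (placed inv x∈)
  alternative-placed inv (mldep _ x∈ α≈ h)     = dependence-placed h α≈ (placed inv x∈)
  alternative-placed inv (dia x∈ g acc∈)       = successors inv acc∈ (placed inv x∈) ∷ []

  universeOver : List ℕ → List (Mark × Label × Fml)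
  universeOver ns = cartesianProduct marks (cartesianProduct (sublists ns) closure)

  open LayeredGrowth (λ (s : Branch × Levels) → Covered (proj₁ s))
                     (λ e s → universeOver (numbersAt e (proj₂ s)))
                     (suc (modalDepth φ₀)) public

  covers-new : ∀ {B B′ W d m α ψ} → (∀ {x} → Covered B x → Covered B′ x) → AtLevel W d α → Closure ψ →
               Covered B′ (m , α , ψ) → ¬ Covered B (m , α , ψ) →
               Covered B′ ⊋[ universeOver (numbersAt d W) ] Covered B
  covers-new {W = W} {d} {m} {α} {ψ} mono at c new ¬old with sublists-complete {ns = numbersAt d W} α⊆
    where
    α⊆ : α ⊆ numbersAt d W
    α⊆ i∈α = ∈-filter⁺ (λ n → level W n ≟ d) (proj₁ (at i∈α)) (proj₂ (at i∈α))
  ... | β , β∈ , β≈α =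
    mono , (m , β , ψ) , ∈-cartesianProduct⁺ (∈-marks m) (∈-cartesianProduct⁺ β∈ (Closure⇒∈closure c)) ,
    Covered-resp-≈ˡ β≈α new , ¬old ∘ Covered-resp-≈ˡ (≈ˡ-sym β≈α)

  rule-invariant : ∀ {L B W A N} → Invariant B W → RuleAlt L B A → Adds B A N →
                   Invariant (branch (items B ++ N) (boxed B)) W
  placed (rule-invariant {B = B} inv alt adds) x∈ with ∈-++⁻ (items B) x∈
  ... | inj₁ old = placed inv old
  ... | inj₂ new =
    PlacedFormula⇒PlacedItem _ (All.lookup (alternative-placed inv alt) (Adds.fromA adds new))
  numbers-occur (rule-invariant {B = B} {N = N} inv _ _) n∈ =
    Occurs-mono {B = B} {branch (items B ++ N) (boxed B)} ∈-++⁺ˡ (numbers-occur inv n∈)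

  rule-grows : ∀ {L B W A} N → Invariant B W → RuleAlt L B A → Adds B A N →
               Grows (branch (items B ++ N) (boxed B) , W) (B , W)
  rule-grows []            _   _   adds = ⊥-elim (Adds.nonempty adds refl)
  rule-grows (acc _ _ ∷ _) inv alt adds =
    ⊥-elim (All.lookup (alternative-placed inv alt) (Adds.fromA adds (here refl)))
  rule-grows {B = B} (lab α ψ ∷ N) inv alt adds
    with d , at , bound , c ← All.lookup (alternative-placed inv alt) (Adds.fromA adds (here refl)) = d , record
      { below-height    = s≤s (≤-trans (m≤m+n d _) bound)
      ; universe-stable = λ _ → refl
      ; grows           = covers-new {m = onBranch} (Covered-mono ∈-++⁺ˡ id) at c
                                     (α , ∈-++⁺ʳ (items B) (here refl) , ≈ˡ-refl) (Adds.fresh adds (here refl))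
      }

  PlacedItem-introduce : ∀ {B W ns e x} → (∀ {n} → Occurs n B → n ∉ ns) → x ∈ items B →
                         PlacedItem W x → PlacedItem (introduce ns e W) x
  PlacedItem-introduce {W = W} {ns = ns} {x = lab β ψ} old∉ns x∈ (d , at , fits) = d , at′ , fits
    where
    at′ : AtLevel (introduce ns _ W) d β
    at′ i∈β = ∈-++⁺ʳ ns (proj₁ (at i∈β)) ,
              trans (level-kept {W = W} (old∉ns (inj₁ (β , ψ , x∈ , i∈β)))) (proj₂ (at i∈β))
  PlacedItem-introduce {W = W} {ns = ns} {x = acc i j} old∉ns x∈ (level-step , j∈) =
    trans (level-kept {W = W} (old∉ns (inj₂ (inj₂ (i , x∈)))))
          (trans level-step (cong suc (sym (level-kept {W = W} (old∉ns (inj₂ (inj₁ (j , x∈)))))))) ,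
    ∈-++⁺ʳ ns j∈

  module BoxStep {B W α φ N} (inv : Invariant B W) (□φ∈ : lab α (□ φ) ∈ items B)
                 (fr : Fin (2 ^ vrank φ) → ℕ) (fresh : ∀ k → ¬ Occurs (fr k) B)
                 (f : Fin (2 ^ vrank φ) → ℕ) (f∈α : ∀ k → f k ∈ α)
                 (adds : Adds B (boxItems f fr φ) N) where

    B′ : Branch
    B′ = branch (items B ++ N) ((α , □ φ) ∷ boxed B)

    d : ℕ
    d = proj₁ (placed inv □φ∈)

    at : AtLevel W d α
    at = proj₁ (proj₂ (placed inv □φ∈))

    fits : Fits d (□ φ)
    fits = proj₂ (proj₂ (placed inv □φ∈))

    W′ : Levels
    W′ = introduce (tabulate fr) (suc d) W

    old∉fresh : ∀ {n} → Occurs n B → n ∉ tabulate fr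
    old∉fresh occ n∈ with ∈-tabulate⁻ n∈
    ... | k , refl = fresh k occ

    new-placed : ∀ {x} → x ∈ boxItems f fr φ → PlacedItem W′ x
    new-placed x∈ with ∈-++⁻ (tabulate (λ k → acc (f k) (fr k))) x∈
    ... | inj₂ (here refl) = suc d , (λ i∈ → ∈-++⁺ˡ i∈ , level-introduced {W = W} i∈) , Fits-□ fits
    ... | inj₁ acc∈ with ∈-tabulate⁻ acc∈
    ...   | k , refl =
      trans (level-introduced {W = W} (∈-tabulate⁺ k)) (cong suc (sym fk-at-d)) , ∈-++⁺ˡ (∈-tabulate⁺ k)
      where
      fk-at-d : level W′ (f k) ≡ d
      fk-at-d = trans (level-kept {W = W} (old∉fresh (inj₁ (α , □ φ , □φ∈ , f∈α k)))) (proj₂ (at (f∈α k)))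

    invariant : Invariant B′ W′
    placed invariant x∈ with ∈-++⁻ (items B) x∈
    ... | inj₁ old = PlacedItem-introduce {B = B} old∉fresh old (placed inv old)
    ... | inj₂ new = new-placed (Adds.fromA adds new)
    numbers-occur invariant n∈ with ∈-++⁻ (tabulate fr) n∈
    ... | inj₂ old = Occurs-mono {B = B} {B′} ∈-++⁺ˡ (numbers-occur inv old)
    ... | inj₁ new with ∈-tabulate⁻ new
    -- accessibility items are never redundant, so the edge into fr k is really added
    ...   | k , refl with Adds.complete adds (∈-++⁺ˡ (∈-tabulate⁺ {f = λ k → acc (f k) (fr k)} k))
    ...     | inj₁ acc∈N = inj₂ (inj₂ (f k , ∈-++⁺ʳ (items B) acc∈N))

    growth : ¬ BoxUsed α (□ φ) B → GrowsAt (B′ , W′) (B , W) d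
    growth unused = record
      { below-height    = s≤s (≤-trans (m≤m+n d _) (proj₁ fits))
      ; universe-stable = λ e′≤d →
          cong universeOver (numbersAt-introduce (old∉fresh ∘ numbers-occur inv) (s≤s e′≤d))
      ; grows           = covers-new {m = expanded} (Covered-mono ∈-++⁺ˡ there) at (proj₂ fits)
                                     (α , here refl , ≈ˡ-refl) unused
      }

  step-grows : ∀ {L B B′ W} → Invariant B W → Step L B B′ →
               ∃[ W′ ] Invariant B′ W′ × Grows (B′ , W′) (B , W)
  step-grows {W = W} inv (rule {N = N} alt adds) =
    W , rule-invariant inv alt adds , rule-grows N inv alt adds
  step-grows inv (box □φ∈ unused fr _ fresh f f∈α adds) = W′ , invariant , d , growth unused
    where open BoxStep inv □φ∈ fr fresh f f∈α adds

  rootLevels : Levels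
  rootLevels = record { level = λ _ → 0 ; numbers = map suc (upTo (2 ^ vrank φ₀)) }

  root-invariant : Invariant (root φ₀) rootLevels
  placed root-invariant (here refl) = 0 , (λ i∈ → i∈ , refl) , ≤-refl , φ₀ , true , ε , refl
  numbers-occur root-invariant n∈ = inj₁ (_ , φ₀ , here refl , n∈)

theorem7 : (L : Logic) (φ : Fml) → L -formula φ → AllTableauxFinite L φ
theorem7 L φ _ = acc-annotated Invariant step-grows root-invariant (grows-wellFounded (root φ , rootLevels))
  where open Termination φ
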